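{- Let $\varphi^*$ be a $\mathcal{GC}^2$-sentence of the form $$\forall x\,\alpha\wedge\bigwedge_{1\leq h\leq l}\forall x\forall y\big(e_h(x,y)\to(\beta_h\vee x\approx y)\big)\wedge\bigwedge_{1\leq i\leq m}\forall x\,\exists_{=C_i}y\big(f_i(x,y)\wedge x\not\approx y\big),$$ where $\alpha$ is a quantifier-free formula with $x$ as its only variable, $e_1,\dots,e_l,f_1,\dots,f_m$ are binary predicates other than $\approx$, $\beta_1,\dots,\beta_l$ are quantifier-free formulas in $x,y$, and $C_1,\dots,C_m$ are positive integers. Suppose $\mathfrak{A}\models\varphi^*$, and let $\hat{\mathfrak{A}}$ be the structure over the same domain obtained by replacing every silent 2-type by the corresponding vacuous 2-type, i.e. for distinct $a,b$: $\mathrm{tp}^{\hat{\mathfrak{A}}}[a,b]=\mathrm{tp}^{\mathfrak{A}}[a]\times\mathrm{tp}^{\mathfrak{A}}[b]$ if $\mathrm{tp}^{\mathfrak{A}}[a,b]$ is silent, and $\mathrm{tp}^{\hat{\mathfrak{A}}}[a,b]=\mathrm{tp}^{\mathfrak{A}}[a,b]$ otherwise (and 1-types are unchanged). Then $\hat{\mathfrak{A}}\models\varphi^*$.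
   Context: Let $\Sigma^*$ be a signature of unary and binary predicates containing those of $\varphi^*$; all structures interpret $\Sigma^*$. A 1-type is a maximal consistent set of equality-free literals over $\Sigma^*$ involving only the variable $x$; a 2-type is a maximal consistent set of equality-free literals over $\Sigma^*$ involving only the variables $x,y$. For $a\in A$, $\mathrm{tp}^{\mathfrak{A}}[a]$ is the unique 1-type $\pi$ with $\mathfrak{A}\models\pi[a]$; for distinct $a,b$, $\mathrm{tp}^{\mathfrak{A}}[a,b]$ is the unique 2-type $\tau$ with $\mathfrak{A}\models\tau[a,b]$. For a 2-type $\tau$, $\tau^{ -1}$ is obtained by swapping $x$ and $y$. The predicates $f_1,\dots,f_m$ are the counting predicates. A 2-type $\tau$ is a message-type if $f_h(x,y)\in\tau$ for some $h$; it is silent if neither $\tau$ nor $\tau^{ -1}$ is a message-type; it is vacuous if neither $q(x,y)$ nor $q(y,x)$ is in $\tau$ for any binary predicate $q$. For 1-types $\pi,\pi'$, $\pi\times\pi'$ is the vacuous 2-type $\pi\cup\pi'[y/x]\cup\{\neg q(x,y),\neg q(y,x): q \text{ binary in }\Sigma^*\}$, where $\pi'[y/x]$ replaces $x$ by $y$ in $\pi'$. -}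

module Defs where

open import Data.Nat using (ℕ; zero; suc; _≤_)
open import Data.Fin using (Fin; zero; suc)
open import Data.Bool using (Bool; true; false; T)
open import Data.Product using (Σ; Σ-syntax; ∃; ∃-syntax; _×_; _,_)
open import Data.Sum using (_⊎_)
open import Data.Empty using (⊥)
open import Data.Unit using (⊤)
open import Relation.Nullary using (¬_)
open import Relation.Binary.PropositionalEquality using (_≡_; _≢_)
open import Function.Definitions using (Injective)

-- Signature Σ*: nU unary predicates, nB binary predicates (equality is
-- not among them; it is handled separately).

record Signature : Set where
  field
    nU : ℕ
    nB : ℕ

module _ (Sig : Signature) where
  open Signature Sig

  record Structure (D : Set) : Set where
    field
      unary  : Fin nU → D → Bool
      binary : Fin nB → D → D → Bool

  data Atom (V : Set) : Set where
    uatom : Fin nU → V → Atom V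
    batom : Fin nB → V → V → Atom V

  -- A maximal consistent set of equality-free literals over V is exactly a
  -- truth assignment to the atoms over V.
  -- 1-types: V = Fin 1 (variable x = zero);
  -- 2-types: V = Fin 2 (x = zero, y = suc zero).
  Type : Set → Set
  Type V = Atom V → Bool

  1-Type : Set
  1-Type = Type (Fin 1)

  2-Type : Set
  2-Type = Type (Fin 2)

  renameAtom : {V W : Set} → (V → W) → Atom V → Atom W
  renameAtom r (uatom P v)   = uatom P (r v)
  renameAtom r (batom q v w) = batom q (r v) (r w)

  tpOf : {D V : Set} → Structure D → (V → D) → Type V
  tpOf 𝔄 ρ (uatom P v)   = Structure.unary 𝔄 P (ρ v)
  tpOf 𝔄 ρ (batom q v w) = Structure.binary 𝔄 q (ρ v) (ρ w)

  tp1 : {D : Set} → Structure D → D → 1-Type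
  tp1 𝔄 a = tpOf 𝔄 (λ _ → a)

  x₂ y₂ : Fin 2
  x₂ = zero
  y₂ = suc zero

  pair : {D : Set} → D → D → Fin 2 → D
  pair a b zero    = a
  pair a b (suc _) = b

  tp2 : {D : Set} → Structure D → D → D → 2-Type
  tp2 𝔄 a b = tpOf 𝔄 (pair a b)

  swap₂ : Fin 2 → Fin 2
  swap₂ zero    = suc zero
  swap₂ (suc _) = zero

  _⁻¹ : 2-Type → 2-Type
  (τ ⁻¹) at = τ (renameAtom swap₂ at)

  -- π × π' : the vacuous 2-type π ∪ π'[y/x] ∪ {¬q(x,y), ¬q(y,x)}
  _⊗_ : 1-Type → 1-Type → 2-Type
  (π ⊗ π') (uatom P zero)          = π (uatom P zero)
  (π ⊗ π') (uatom P (suc _))       = π' (uatom P zero)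
  (π ⊗ π') (batom q zero zero)     = π (batom q zero zero)
  (π ⊗ π') (batom q (suc _) (suc _)) = π' (batom q zero zero)
  (π ⊗ π') (batom q zero (suc _))  = false
  (π ⊗ π') (batom q (suc _) zero)  = false

  IsMessageType : {m : ℕ} → (Fin m → Fin nB) → 2-Type → Set
  IsMessageType f τ = ∃[ h ] τ (batom (f h) x₂ y₂) ≡ true

  IsSilent : {m : ℕ} → (Fin m → Fin nB) → 2-Type → Set
  IsSilent f τ = ¬ IsMessageType f τ × ¬ IsMessageType f (τ ⁻¹)

  data QF (V : Set) : Set where
    tt ff : QF V
    un    : Fin nU → V → QF V
    bin   : Fin nB → V → V → QF V
    eq    : V → V → QF V
    neg   : QF V → QF V
    _and_ _or_ : QF V → QF V → QF V

  ⟦_⟧ : {D V : Set} → QF V → Structure D → (V → D) → Set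
  ⟦ tt ⟧ 𝔄 ρ = ⊤
  ⟦ ff ⟧ 𝔄 ρ = ⊥
  ⟦ un P v ⟧ 𝔄 ρ = T (Structure.unary 𝔄 P (ρ v))
  ⟦ bin q v w ⟧ 𝔄 ρ = T (Structure.binary 𝔄 q (ρ v) (ρ w))
  ⟦ eq v w ⟧ 𝔄 ρ = ρ v ≡ ρ w
  ⟦ neg φ ⟧ 𝔄 ρ = ¬ ⟦ φ ⟧ 𝔄 ρ
  ⟦ φ and ψ ⟧ 𝔄 ρ = ⟦ φ ⟧ 𝔄 ρ × ⟦ ψ ⟧ 𝔄 ρ
  ⟦ φ or ψ ⟧ 𝔄 ρ = ⟦ φ ⟧ 𝔄 ρ ⊎ ⟦ ψ ⟧ 𝔄 ρ

  -- "there are exactly n elements satisfying P": a bijection Fin n ≅ {b | P b}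
  ExactlyN : {D : Set} → ℕ → (D → Set) → Set
  ExactlyN {D} n P =
    Σ[ g ∈ (Fin n → D) ] Injective _≡_ _≡_ g
      × (∀ k → P (g k)) × (∀ b → P b → ∃[ k ] g k ≡ b)

  record NormalForm : Set where
    field
      l m   : ℕ
      α     : QF (Fin 1)
      e     : Fin l → Fin nB
      β     : Fin l → QF (Fin 2)
      f     : Fin m → Fin nB
      C     : Fin m → ℕ
      C-pos : ∀ i → 1 ≤ C i

  _⊨_ : {D : Set} → Structure D → NormalForm → Set
  _⊨_ {D} 𝔄 φ =
      (∀ (a : D) → ⟦ α ⟧ 𝔄 (λ _ → a))
    × (∀ h (a b : D) → T (Structure.binary 𝔄 (e h) a b) →
         ⟦ β h ⟧ 𝔄 (pair a b) ⊎ a ≡ b)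
    × (∀ i (a : D) →
         ExactlyN (C i) (λ b → T (Structure.binary 𝔄 (f i) a b) × a ≢ b))
    where open NormalForm φ

  IsSilencing : {D : Set} {m : ℕ} → (Fin m → Fin nB) →
                Structure D → Structure D → Set
  IsSilencing {D} f 𝔄 𝔅 =
      (∀ (a : D) at → tp1 𝔅 a at ≡ tp1 𝔄 a at)
    × (∀ (a b : D) → a ≢ b →
         (IsSilent f (tp2 𝔄 a b) →
            ∀ at → tp2 𝔅 a b at ≡ (tp1 𝔄 a ⊗ tp1 𝔄 b) at)
       × (¬ IsSilent f (tp2 𝔄 a b) →
            ∀ at → tp2 𝔅 a b at ≡ tp2 𝔄 a b at))

-- Satisfaction of a quantifier-free formula only depends on the type realised
-- by the assignment.  The silencing keeps every 1-type, and keeps the 2-type of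
-- every pair that is joined by some edge of Â (a silent pair of Â is vacuous,
-- hence edgeless).  So ∀x α and the guarded conjuncts ∀x∀y (e_h → β_h ∨ x≈y)
-- transfer from 𝔄 to Â.  An f_i-edge between distinct elements makes the pair
-- a message-type, hence not silent, so each element has the same f_i-successors
-- in 𝔄 and Â and the counting conjuncts transfer as well.
module Submission where

open import Defs
open import Data.Nat using (ℕ)
open import Data.Fin using (Fin; zero; suc)
open import Data.Bool using (T)
open import Data.Bool.Properties using (T-≡) renaming (_≟_ to _≟ᵇ_)
open import Data.Product using (_×_; _,_; proj₁; proj₂)
import Data.Product as Product
import Data.Sum as Sum
open import Function using (_∘_; _⇔_; mk⇔)
open import Function.Bundles using (Equivalence)
open import Relation.Nullary using (¬_; Dec; yes; no)
open import Relation.Nullary.Decidable using (decidable-stable; ¬¬-excluded-middle)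
open import Relation.Nullary.Negation using (¬¬-map)
open import Relation.Binary.PropositionalEquality
  using (_≡_; _≢_; refl; sym; subst)

ExactlyN-cong : (Sig : Signature) {D : Set} {n : ℕ} {P Q : D → Set} →
                (∀ b → P b ⇔ Q b) → ExactlyN Sig n P → ExactlyN Sig n Q
ExactlyN-cong _ P⇔Q (g , g-injective , g-sound , g-complete) =
  g , g-injective , (λ k → Equivalence.to (P⇔Q (g k)) (g-sound k))
    , (λ b → g-complete b ∘ Equivalence.from (P⇔Q b))

module _ {Sig : Signature} where
  open Signature Sig

  AgreeAt : {D V : Set} → Structure Sig D → Structure Sig D → (V → D) → Set
  AgreeAt 𝔄 𝔅 ρ = ∀ at → tpOf Sig 𝔄 ρ at ≡ tpOf Sig 𝔅 ρ at

  ⟦⟧-transport : {D V : Set} {𝔄 𝔅 : Structure Sig D} {ρ : V → D} →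
                 AgreeAt 𝔄 𝔅 ρ → (φ : QF Sig V) → ⟦_⟧ Sig φ 𝔄 ρ → ⟦_⟧ Sig φ 𝔅 ρ
  ⟦⟧-transport ag tt          p = p
  ⟦⟧-transport ag ff          p = p
  ⟦⟧-transport ag (un P v)    p = subst T (ag (uatom P v)) p
  ⟦⟧-transport ag (bin q v w) p = subst T (ag (batom q v w)) p
  ⟦⟧-transport ag (eq v w)    p = p
  ⟦⟧-transport ag (neg φ)     p = p ∘ ⟦⟧-transport (sym ∘ ag) φ
  ⟦⟧-transport ag (φ and ψ)   p = Product.map (⟦⟧-transport ag φ) (⟦⟧-transport ag ψ) p
  ⟦⟧-transport ag (φ or ψ)    p = Sum.map (⟦⟧-transport ag φ) (⟦⟧-transport ag ψ) p

  AgreeOn1Types : {D : Set} → Structure Sig D → Structure Sig D → Set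
  AgreeOn1Types {D} 𝔄 𝔅 = (a : D) → AgreeAt {V = Fin 1} 𝔄 𝔅 (λ _ → a)

  agreeAt-diagonal : {D : Set} {𝔄 𝔅 : Structure Sig D} → AgreeOn1Types 𝔄 𝔅 →
                     (a : D) → AgreeAt 𝔄 𝔅 (pair Sig a a)
  agreeAt-diagonal ag a (uatom P zero)            = ag a (uatom P zero)
  agreeAt-diagonal ag a (uatom P (suc _))         = ag a (uatom P zero)
  agreeAt-diagonal ag a (batom q zero zero)       = ag a (batom q zero zero)
  agreeAt-diagonal ag a (batom q zero (suc _))    = ag a (batom q zero zero)
  agreeAt-diagonal ag a (batom q (suc _) zero)    = ag a (batom q zero zero)
  agreeAt-diagonal ag a (batom q (suc _) (suc _)) = ag a (batom q zero zero)

  module Silencing {D : Set} {m : ℕ} {f : Fin m → Fin nB} {𝔄 𝔄̂ : Structure Sig D}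
                   (silencing : IsSilencing Sig f 𝔄 𝔄̂) where

    agreeOn1Types : AgreeOn1Types 𝔄 𝔄̂
    agreeOn1Types a at = sym (proj₁ silencing a at)

    agreeAt-nonSilent : {a b : D} → a ≢ b → ¬ IsSilent Sig f (tp2 Sig 𝔄 a b) →
                        AgreeAt 𝔄 𝔄̂ (pair Sig a b)
    agreeAt-nonSilent a≢b ¬silent at = sym (proj₂ (proj₂ silencing _ _ a≢b) ¬silent at)

    edge-nonSilent : ∀ {q a b} → a ≢ b → T (Structure.binary 𝔄̂ q a b) →
                     ¬ IsSilent Sig f (tp2 Sig 𝔄 a b)
    edge-nonSilent {q} a≢b edge silent =
      subst T (proj₁ (proj₂ silencing _ _ a≢b) silent (batom q (x₂ Sig) (y₂ Sig))) edge

    -- Equality on D need not be decidable; the case split on a ≡ b is done under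
    -- ¬¬, which is harmless because the goal is an equation between booleans.
    agreeAt-edge : ∀ {q a b} → T (Structure.binary 𝔄̂ q a b) → AgreeAt 𝔄 𝔄̂ (pair Sig a b)
    agreeAt-edge {a = a} {b} edge at = decidable-stable (_ ≟ᵇ _) (¬¬-map agree ¬¬-excluded-middle)
      where
      agree : Dec (a ≡ b) → tpOf Sig 𝔄 (pair Sig a b) at ≡ tpOf Sig 𝔄̂ (pair Sig a b) at
      agree (yes refl) = agreeAt-diagonal agreeOn1Types a at
      agree (no a≢b)   = agreeAt-nonSilent a≢b (edge-nonSilent a≢b edge) at

    edge-reflected : ∀ {q a b} → T (Structure.binary 𝔄̂ q a b) → T (Structure.binary 𝔄 q a b)
    edge-reflected {q} edge = subst T (sym (agreeAt-edge edge (batom q (x₂ Sig) (y₂ Sig)))) edge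

    messageSuccessor-preserved : ∀ {i a b} →
      (T (Structure.binary 𝔄 (f i) a b) × a ≢ b) ⇔ (T (Structure.binary 𝔄̂ (f i) a b) × a ≢ b)
    messageSuccessor-preserved {i} = mk⇔
      (λ (edge , a≢b) →
         subst T (agreeAt-nonSilent a≢b (nonSilent edge) (batom (f i) (x₂ Sig) (y₂ Sig))) edge , a≢b)
      (Product.map₁ edge-reflected)
      where
      nonSilent : ∀ {a b} → T (Structure.binary 𝔄 (f i) a b) → ¬ IsSilent Sig f (tp2 Sig 𝔄 a b)
      nonSilent edge silent = proj₁ silent (i , Equivalence.to T-≡ edge)

open Silencing

lemma10 : (Sig : Signature) (φ : NormalForm Sig) {D : Set}
          (𝔄 𝔄̂ : Structure Sig D) →
          _⊨_ Sig 𝔄 φ →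
          IsSilencing Sig (NormalForm.f φ) 𝔄 𝔄̂ →
          _⊨_ Sig 𝔄̂ φ
lemma10 Sig φ 𝔄 𝔄̂ (⊨α , ⊨guards , ⊨counts) silencing =
    (λ a → ⟦⟧-transport (agreeOn1Types silencing a) α (⊨α a))
  , (λ h a b edge → Sum.map₁ (⟦⟧-transport (agreeAt-edge silencing edge) (β h))
                             (⊨guards h a b (edge-reflected silencing edge)))
  , (λ i a → ExactlyN-cong Sig (λ b → messageSuccessor-preserved silencing) (⊨counts i a))
  where open NormalForm φ
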